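{- For any tangle $\mathcal{T}$ other than the six basic stringable tangles, $\epsilon(\mathcal{T})-\sigma_3(\mathcal{T})\ge 2$.
   Context: A tangle is a connected topological space obtained by taking finitely many disjoint copies of $[0,1]$ and identifying some of their endpoints (quotient topology); homeomorphic tangles are regarded as identical. The degree of a point $x$ is the number $k$ such that a small neighborhood of $x$ is homeomorphic to $k$ copies of $[0,1)$ glued at $0$ (with $x$ at $0$). Points of degree $1$ or at least $3$ are singular; an edge is a connected component of the space obtained by removing all singular points. $\sigma_3(\mathcal{T})$ is the number of singular points of degree at least $3$, and $\epsilon(\mathcal{T})$ is the number of edges. The six basic stringable tangles are: the closed unit interval; the circle; the lollipop (a circle with a segment attached at one endpoint to a point of the circle); the figure 8 (two circles sharing exactly one point); the handcuffs (two disjoint circles joined by a segment with one endpoint on each); and the theta (two points joined by three internally disjoint arcs). -}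

module Defs where

open import Data.Nat using (ℕ; zero; suc; _≤_; _≤?_; _+_)
open import Data.Fin using (Fin; zero; suc; _≟_)
open import Data.Bool using (Bool; true; false; if_then_else_; _∧_; _xor_)
open import Data.List using (List; allFin; map; filter; length; _∷_; [])
open import Data.Nat.ListAction using (sum)
open import Data.Product using (Σ; ∃; ∃₂; _×_; _,_)
open import Data.Sum using (_⊎_)
open import Relation.Nullary using (¬_)
open import Relation.Nullary.Decidable using (isYes)
open import Relation.Binary.PropositionalEquality using (_≡_)
open import Relation.Binary.Construct.Closure.ReflexiveTransitive using (Star)
open import Relation.Binary.Construct.Closure.Equivalence using (EqClosure)
open import Function.Bundles using (_↔_; Inverse)

-- Combinatorial model of a tangle.
-- nI copies of [0,1] (intervals), numbered by Fin nI; endpoint (i , b)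
-- is 0 of copy i if b = false and 1 of copy i if b = true.  The
-- identification of endpoints is given by a map `end` onto the set
-- Fin nV of glued endpoint classes (the "vertices").

record RawTangle : Set where
  field
    nI   : ℕ
    nV   : ℕ
    end  : Fin nI → Bool → Fin nV

open RawTangle public

Adj : (T : RawTangle) → Fin (nV T) → Fin (nV T) → Set
Adj T x y = ∃ λ i → (end T i false ≡ x × end T i true ≡ y)
                  ⊎ (end T i true ≡ x × end T i false ≡ y)

record Tangle : Set where
  field
    raw       : RawTangle
    nonempty  : 1 ≤ nI raw
    surj      : ∀ (x : Fin (nV raw)) → ∃₂ λ i b → end raw i b ≡ x
    connected : ∀ (x y : Fin (nV raw)) → Star (Adj raw) x y

open Tangle public

-- Degrees.  Interior points of the intervals have degree 2; the degree
-- of a vertex is the number of interval endpoints glued into it.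

ind : Bool → ℕ
ind true  = 1
ind false = 0

degree : (T : RawTangle) → Fin (nV T) → ℕ
degree T x = sum (map (λ i → ind (isYes (end T i false ≟ x))
                            + ind (isYes (end T i true ≟ x)))
                      (allFin (nI T)))

σ₃ : RawTangle → ℕ
σ₃ T = length (filter (λ x → 3 ≤? degree T x) (allFin (nV T)))

-- Two intervals whose interiors lie in the same edge: they share an
-- endpoint class which is a (non-singular) point of degree 2.
Link : (T : RawTangle) → Fin (nI T) → Fin (nI T) → Set
Link T i j = ∃₂ λ b b' → end T i b ≡ end T j b' × degree T (end T i b) ≡ 2

-- `EdgeCount T e` : T has exactly e edges, i.e. the edges
-- (components of T minus its singular points) are in bijection with
-- Fin e via a labelling c of the intervals: each edge is the union of
-- the interiors of the intervals connected through degree-2 vertices.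
EdgeCount : RawTangle → ℕ → Set
EdgeCount T e =
  Σ (Fin (nI T) → Fin e) λ c →
    (∀ (k : Fin e) → ∃ λ i → c i ≡ k) ×
    (∀ i j → c i ≡ c j → Star (Link T) i j) ×
    (∀ i j → Star (Link T) i j → c i ≡ c j)

-- Homeomorphism of tangles (combinatorial / PL version): the
-- equivalence relation generated by isomorphism and elementary
-- subdivision of an interval.

record Iso (A B : RawTangle) : Set where
  field
    intervals : Fin (nI A) ↔ Fin (nI B)
    vertices  : Fin (nV A) ↔ Fin (nV B)
    flip      : Fin (nI A) → Bool
    compat    : ∀ i b → end B (Inverse.to intervals i) (b xor flip i)
                        ≡ Inverse.to vertices (end A i b)

-- subdivide interval k at an interior point: the new vertex is `zero`,
-- the new interval `zero` runs from the new vertex to the old end 1 of k,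
-- and the old interval k now ends (at 1) in the new vertex.
subdivide : (A : RawTangle) → Fin (nI A) → RawTangle
subdivide A k = record { nI = suc (nI A) ; nV = suc (nV A) ; end = e }
  where
  e : Fin (suc (nI A)) → Bool → Fin (suc (nV A))
  e zero false = zero
  e zero true  = suc (end A k true)
  e (suc i) b  = if isYes (i ≟ k) ∧ b then zero else suc (end A i b)

Step : RawTangle → RawTangle → Set
Step A B = Iso A B ⊎ Σ (Fin (nI A)) (λ k → Iso (subdivide A k) B)

Homeomorphic : RawTangle → RawTangle → Set
Homeomorphic = EqClosure Step

interval : RawTangle
interval = record { nI = 1 ; nV = 2 ; end = λ _ b → if b then suc zero else zero }

circle : RawTangle
circle = record { nI = 1 ; nV = 1 ; end = λ _ _ → zero }

lollipop : RawTangle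
lollipop = record { nI = 2 ; nV = 2 ; end = e }
  where
  e : Fin 2 → Bool → Fin 2
  e zero _             = zero
  e (suc zero) false   = zero
  e (suc zero) true    = suc zero

figure8 : RawTangle
figure8 = record { nI = 2 ; nV = 1 ; end = λ _ _ → zero }

handcuffs : RawTangle
handcuffs = record { nI = 3 ; nV = 2 ; end = e }
  where
  e : Fin 3 → Bool → Fin 2
  e zero _                   = zero
  e (suc zero) _             = suc zero
  e (suc (suc zero)) false   = zero
  e (suc (suc zero)) true    = suc zero

theta : RawTangle
theta = record { nI = 3 ; nV = 2 ; end = λ _ b → if b then suc zero else zero }

basicStringable : List RawTangle
basicStringable = interval ∷ circle ∷ lollipop ∷ figure8 ∷ handcuffs ∷ theta ∷ []

-- σ₃ and the number of edges are invariant under subdividing an interval, so every vertex of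
-- degree 2 can be smoothed away, unless it lies on a loop, in which case the tangle is a circle.
-- Once no vertex has degree 2 the edges are exactly the intervals, and the handshake lemma (the
-- degrees add up to twice the number of intervals; every vertex has degree ≥ 1 and the σ₃
-- singular ones degree ≥ 3) gives #vertices + 2σ₃ ≤ 2·#intervals.  Hence ε ≤ σ₃ + 1 leaves at
-- most 3 intervals and 2 vertices, and an exhaustive check of these finitely many tangles finds
-- each of them isomorphic to a basic stringable tangle.

module Submission where

open import Defs
open import Data.Nat using (ℕ; zero; suc; _≤_; _<_; _≤?_; _+_; _*_; z≤n; s≤s; s≤s⁻¹; pred; >-nonZero⁻¹)
import Data.Nat.Properties as ℕ
import Data.Nat.ListAction as ListAction
open import Data.Fin using (Fin; zero; suc; _≟_; punchOut; pinch)
import Data.Fin.Properties as Fin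
open import Data.Fin.Permutation as Perm using (Permutation; _⟨$⟩ʳ_; _⟨$⟩ˡ_; _∘ₚ_)
open import Data.Bool using (Bool; true; false; _xor_; not; _∧_; if_then_else_)
import Data.Bool.Properties as Bool
open import Data.List using (List; []; _∷_; map; filter; length; tabulate; concatMap; allFin; cartesianProduct)
open import Data.List.Relation.Unary.Any using (Any; here; there; any?; satisfied)
open import Data.List.Membership.Propositional using (_∈_; find)
open import Data.Vec using (Vec; []; _∷_; lookup)
import Data.Vec as Vec
open import Data.Vec.Properties using (lookup∘tabulate)
open import Data.Product using (∃; ∃₂; _×_; _,_; proj₁; proj₂)
open import Data.Sum using (_⊎_; inj₁; inj₂)
import Data.Sum as Sum
open import Data.Vec.Functional using (removeAt)
open import Function using (_∘_)
open import Function.Bundles using (Injection)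
open import Function.Properties.Inverse using (↔⇒↣)
open import Relation.Nullary using (¬_; Dec; yes; no; contradiction; map′)
open import Relation.Unary using (Decidable)
open import Relation.Nullary.Decidable using (isYes; from-yes; _×-dec_; _⊎-dec_; _→-dec_)
open import Relation.Binary.PropositionalEquality
open import Relation.Binary.Construct.Closure.Symmetric using (fwd; bwd)
open import Relation.Binary.Construct.Closure.ReflexiveTransitive
  using (Star; ε; _◅_; _◅◅_; gmap; kleisliStar; reverse)
open import Algebra.Properties.CommutativeSemigroup ℕ.+-commutativeSemigroup using (x∙yz≈y∙xz)
open import Algebra.Properties.Semiring.Sum ℕ.+-*-semiring using (*-distribʳ-sum)
open import Algebra.Properties.CommutativeMonoid.Sum ℕ.+-0-commutativeMonoid
  using (sum; sum-cong-≗; sum-remove; ∑-distrib-+; ∑-comm; ∑-permute)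

sum-const : ∀ n c → sum {n} (λ _ → c) ≡ n * c
sum-const zero    c = refl
sum-const (suc n) c = cong (c +_) (sum-const n c)

sum-mono-≤ : ∀ {n} {f g : Fin n → ℕ} → (∀ i → f i ≤ g i) → sum f ≤ sum g
sum-mono-≤ {zero}  _   = z≤n
sum-mono-≤ {suc n} f≤g = ℕ.+-mono-≤ (f≤g zero) (sum-mono-≤ (f≤g ∘ suc))

term≤sum : ∀ {n} (f : Fin n → ℕ) i → f i ≤ sum f
term≤sum {suc n} f i = ℕ.≤-trans (ℕ.m≤m+n (f i) _) (ℕ.≤-reflexive (sym (sum-remove f)))

two-terms≤sum : ∀ {n} (f : Fin n → ℕ) {i j} → i ≢ j → f i + f j ≤ sum f
two-terms≤sum {suc n} f {i} {j} i≢j = begin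
  f i + f j                     ≡⟨ cong (λ l → f i + f l) (Fin.punchIn-punchOut i≢j) ⟨
  f i + removeAt f i l          ≤⟨ ℕ.+-monoʳ-≤ (f i) (term≤sum (removeAt f i) l) ⟩
  f i + sum (removeAt f i)      ≡⟨ sum-remove f ⟨
  sum f                         ∎
  where
  open ℕ.≤-Reasoning
  l = punchOut i≢j

sum-pos : ∀ {n} (f : Fin n → ℕ) → 0 < sum f → ∃ λ i → 0 < f i
sum-pos {suc n} f 0<sum with f zero in eq
... | suc _ = zero , subst (0 <_) (sym eq) (s≤s z≤n)
... | zero  = let i , 0<fi = sum-pos (f ∘ suc) 0<sum in suc i , 0<fi

sum-bump : ∀ {n} (f g : Fin n → ℕ) k c → f k ≡ c + g k → (∀ i → i ≢ k → f i ≡ g i) →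
           sum f ≡ c + sum g
sum-bump f g zero    c fk≡c+gk f≗g = trans (cong₂ _+_ fk≡c+gk (sum-cong-≗ (λ i → f≗g (suc i) λ ())))
                                          (ℕ.+-assoc c (g zero) _)
sum-bump f g (suc k) c fk≡c+gk f≗g =
  trans (cong₂ _+_ (f≗g zero λ ())
                   (sum-bump (f ∘ suc) (g ∘ suc) k c fk≡c+gk
                             λ i i≢k → f≗g (suc i) (i≢k ∘ Fin.suc-injective)))
        (x∙yz≈y∙xz (g zero) c _)

sum-tabulate : ∀ {n} {A : Set} (h : Fin n → A) (g : A → ℕ) →
               ListAction.sum (map g (tabulate h)) ≡ sum (g ∘ h)
sum-tabulate {zero}  h g = refl
sum-tabulate {suc n} h g = cong (g (h zero) +_) (sum-tabulate (h ∘ suc) g)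

length-filter-tabulate : ∀ {n} {A : Set} {P : A → Set} (P? : ∀ a → Dec (P a)) (h : Fin n → A) →
                         length (filter P? (tabulate h)) ≡ sum (λ i → ind (isYes (P? (h i))))
length-filter-tabulate {zero}  P? h = refl
length-filter-tabulate {suc n} P? h with P? (h zero)
... | yes _ = cong suc (length-filter-tabulate P? (h ∘ suc))
... | no  _ = length-filter-tabulate P? (h ∘ suc)

δ : ∀ {n} → Fin n → Fin n → ℕ
δ x y = ind (isYes (x ≟ y))

δ-≡ : ∀ {n} {x y : Fin n} → x ≡ y → δ x y ≡ 1
δ-≡ {x = x} {y} x≡y with x ≟ y
... | yes _   = refl
... | no  x≢y = contradiction x≡y x≢y

δ-≢ : ∀ {n} {x y : Fin n} → x ≢ y → δ x y ≡ 0
δ-≢ {x = x} {y} x≢y with x ≟ y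
... | yes x≡y = contradiction x≡y x≢y
... | no  _   = refl

δ-pos : ∀ {n} {x y : Fin n} → 0 < δ x y → x ≡ y
δ-pos {x = x} {y} 0<δ with x ≟ y
... | yes x≡y = x≡y

δ-injective : ∀ {n m} {f : Fin n → Fin m} → (∀ {x y} → f x ≡ f y → x ≡ y) →
              ∀ x y → δ (f x) (f y) ≡ δ x y
δ-injective {f = f} inj x y with x ≟ y
... | yes x≡y = δ-≡ (cong f x≡y)
... | no  x≢y = δ-≢ (x≢y ∘ inj)

δ-suc : ∀ {n} (x y : Fin n) → δ (suc x) (suc y) ≡ δ x y
δ-suc = δ-injective Fin.suc-injective

sum-δ : ∀ {n} (x : Fin n) → sum (δ x) ≡ 1
sum-δ {suc n} zero    = cong suc (begin
  sum {n} (δ zero ∘ suc) ≡⟨ sum-cong-≗ {n} (λ y → δ-≢ {x = zero} {suc y} λ ()) ⟩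
  sum {n} (λ _ → 0)    ≡⟨ sum-const n 0 ⟩
  n * 0                ≡⟨ ℕ.*-zeroʳ n ⟩
  0                    ∎)
  where open ≡-Reasoning
sum-δ {suc n} (suc x) = trans (sum-cong-≗ (δ-suc x)) (sum-δ x)

incidence : (A : RawTangle) → Fin (nV A) → Fin (nI A) → ℕ
incidence A x i = δ (end A i false) x + δ (end A i true) x

degree≡sum-incidence : ∀ A x → degree A x ≡ sum (incidence A x)
degree≡sum-incidence A x = sum-tabulate (λ i → i) (incidence A x)

handshake : ∀ A → sum (degree A) ≡ nI A * 2
handshake A = begin
  sum (degree A)                          ≡⟨ sum-cong-≗ (degree≡sum-incidence A) ⟩
  sum (λ x → sum (λ i → incidence A x i)) ≡⟨ ∑-comm (incidence A) ⟩
  sum (λ i → sum (λ x → incidence A x i)) ≡⟨ sum-cong-≗ two-ends ⟩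
  sum {nI A} (λ _ → 2)                    ≡⟨ sum-const (nI A) 2 ⟩
  nI A * 2                                ∎
  where
  open ≡-Reasoning
  two-ends : ∀ i → sum (λ x → incidence A x i) ≡ 2
  two-ends i = trans (∑-distrib-+ (δ (end A i false)) (δ (end A i true)))
                     (cong₂ _+_ (sum-δ (end A i false)) (sum-δ (end A i true)))

1≤incidence-end : ∀ A i b → 1 ≤ incidence A (end A i b) i
1≤incidence-end A i false rewrite δ-≡ (refl {x = end A i false}) = s≤s z≤n
1≤incidence-end A i true  rewrite δ-≡ (refl {x = end A i true})  = ℕ.m≤n+m 1 _

1≤degree-end : ∀ A i b → 1 ≤ degree A (end A i b)
1≤degree-end A i b = ℕ.≤-trans (1≤incidence-end A i b)
  (ℕ.≤-trans (term≤sum (incidence A (end A i b)) i) (ℕ.≤-reflexive (sym (degree≡sum-incidence A _))))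

end-at : ∀ A x i → 1 ≤ incidence A x i → ∃ λ b → end A i b ≡ x
end-at A x i 1≤inc with end A i false ≟ x
... | yes eq = false , eq
... | no  _  = true , δ-pos 1≤inc

χ₃ : ℕ → ℕ
χ₃ d = ind (isYes (3 ≤? d))

σ₃≡sum : ∀ A → σ₃ A ≡ sum (χ₃ ∘ degree A)
σ₃≡sum A = length-filter-tabulate (λ x → 3 ≤? degree A x) (λ x → x)

xor-cancelʳ : ∀ b c → (b xor c) xor c ≡ b
xor-cancelʳ b c = begin
  (b xor c) xor c ≡⟨ Bool.xor-assoc b c c ⟩
  b xor (c xor c) ≡⟨ cong (b xor_) (Bool.xor-same c) ⟩
  b xor false     ≡⟨ Bool.xor-identityʳ b ⟩
  b               ∎
  where open ≡-Reasoning

Iso-sym : ∀ {A B} → Iso A B → Iso B A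
Iso-sym {A} {B} I = record
  { intervals = Perm.flip intervals
  ; vertices  = Perm.flip vertices
  ; flip      = flip ∘ (intervals ⟨$⟩ˡ_)
  ; compat    = compat⁻¹
  }
  where
  open Iso I
  compat⁻¹ : ∀ j b → end A (intervals ⟨$⟩ˡ j) (b xor flip (intervals ⟨$⟩ˡ j)) ≡
                     vertices ⟨$⟩ˡ end B j b
  compat⁻¹ j b = begin
    end A i (b xor flip i)
      ≡⟨ Perm.inverseˡ vertices ⟨
    vertices ⟨$⟩ˡ (vertices ⟨$⟩ʳ end A i (b xor flip i))
      ≡⟨ cong (vertices ⟨$⟩ˡ_) (compat i (b xor flip i)) ⟨
    vertices ⟨$⟩ˡ end B (intervals ⟨$⟩ʳ i) ((b xor flip i) xor flip i)
      ≡⟨ cong₂ (λ j′ b′ → vertices ⟨$⟩ˡ end B j′ b′) (Perm.inverseʳ intervals) (xor-cancelʳ b (flip i)) ⟩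
    vertices ⟨$⟩ˡ end B j b
      ∎
    where
    open ≡-Reasoning
    i = intervals ⟨$⟩ˡ j

Iso-trans : ∀ {A B C} → Iso A B → Iso B C → Iso A C
Iso-trans {A} {B} {C} I J = record
  { intervals = I.intervals ∘ₚ J.intervals
  ; vertices  = I.vertices ∘ₚ J.vertices
  ; flip      = λ i → I.flip i xor J.flip (I.intervals ⟨$⟩ʳ i)
  ; compat    = λ i b → begin
      end C (J.intervals ⟨$⟩ʳ (I.intervals ⟨$⟩ʳ i)) (b xor (I.flip i xor J.flip (I.intervals ⟨$⟩ʳ i)))
        ≡⟨ cong (end C _) (Bool.xor-assoc b _ _) ⟨
      end C (J.intervals ⟨$⟩ʳ (I.intervals ⟨$⟩ʳ i)) ((b xor I.flip i) xor J.flip (I.intervals ⟨$⟩ʳ i))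
        ≡⟨ J.compat (I.intervals ⟨$⟩ʳ i) (b xor I.flip i) ⟩
      J.vertices ⟨$⟩ʳ end B (I.intervals ⟨$⟩ʳ i) (b xor I.flip i)
        ≡⟨ cong (J.vertices ⟨$⟩ʳ_) (I.compat i b) ⟩
      J.vertices ⟨$⟩ʳ (I.vertices ⟨$⟩ʳ end A i b) ∎
  }
  where
  module I = Iso I
  module J = Iso J
  open ≡-Reasoning

module _ {A B : RawTangle} (I : Iso A B) where
  open Iso I

  private
    φ = intervals ⟨$⟩ʳ_
    ψ = vertices ⟨$⟩ʳ_

    δ-iso : ∀ {x y z} → y ≡ ψ z → δ y (ψ x) ≡ δ z x
    δ-iso refl = δ-injective (Injection.injective (↔⇒↣ vertices)) _ _

  incidence-iso : ∀ x i → incidence B (ψ x) (φ i) ≡ incidence A x i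
  incidence-iso x i with flip i | compat i false | compat i true
  ... | false | c₀ | c₁ = cong₂ _+_ (δ-iso c₀) (δ-iso c₁)
  ... | true  | c₁ | c₀ = trans (cong₂ _+_ (δ-iso c₀) (δ-iso c₁)) (ℕ.+-comm (δ (end A i true) x) _)

  degree-iso : ∀ x → degree B (ψ x) ≡ degree A x
  degree-iso x = begin
    degree B (ψ x)                ≡⟨ degree≡sum-incidence B (ψ x) ⟩
    sum (incidence B (ψ x))       ≡⟨ ∑-permute (incidence B (ψ x)) intervals ⟩
    sum (incidence B (ψ x) ∘ φ)   ≡⟨ sum-cong-≗ (incidence-iso x) ⟩
    sum (incidence A x)           ≡⟨ degree≡sum-incidence A x ⟨
    degree A x                    ∎
    where open ≡-Reasoning

  σ₃-iso : σ₃ B ≡ σ₃ A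
  σ₃-iso = begin
    σ₃ B                             ≡⟨ σ₃≡sum B ⟩
    sum (χ₃ ∘ degree B)        ≡⟨ ∑-permute (χ₃ ∘ degree B) vertices ⟩
    sum (χ₃ ∘ degree B ∘ ψ)    ≡⟨ sum-cong-≗ (cong χ₃ ∘ degree-iso) ⟩
    sum (χ₃ ∘ degree A)        ≡⟨ σ₃≡sum A ⟨
    σ₃ A                             ∎
    where open ≡-Reasoning

  Link-iso : ∀ {i j} → Link A i j → Link B (φ i) (φ j)
  Link-iso {i} {j} (b , b′ , shared , deg2) =
    b xor flip i , b′ xor flip j ,
    trans (compat i b) (trans (cong ψ shared) (sym (compat j b′))) ,
    trans (cong (degree B) (compat i b)) (trans (degree-iso _) deg2)

  Adj-iso : ∀ {x y} → Adj A x y → Adj B (ψ x) (ψ y)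
  Adj-iso (i , ends) with flip i | compat i false | compat i true
  Adj-iso (i , inj₁ (refl , refl)) | false | c₀ | c₁ = φ i , inj₁ (c₀ , c₁)
  Adj-iso (i , inj₂ (refl , refl)) | false | c₀ | c₁ = φ i , inj₂ (c₁ , c₀)
  Adj-iso (i , inj₁ (refl , refl)) | true  | c₁ | c₀ = φ i , inj₂ (c₁ , c₀)
  Adj-iso (i , inj₂ (refl , refl)) | true  | c₁ | c₀ = φ i , inj₁ (c₀ , c₁)

EdgeCount-iso : ∀ {A B e} → Iso A B → EdgeCount A e → EdgeCount B e
EdgeCount-iso {A} {B} I (c , onto , same⇒linked , linked⇒same) =
  c ∘ (intervals ⟨$⟩ˡ_) ,
  (λ k → let i , ci≡k = onto k in intervals ⟨$⟩ʳ i , trans (cong c (Perm.inverseˡ intervals)) ci≡k) ,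
  (λ j j′ eq → subst₂ (Star (Link B)) (Perm.inverseʳ intervals) (Perm.inverseʳ intervals)
                 (gmap _ (Link-iso I) (same⇒linked _ _ eq))) ,
  (λ j j′ path → linked⇒same _ _ (gmap _ (Link-iso (Iso-sym I)) path))
  where open Iso I

Tangle-iso : (T : Tangle) {B : RawTangle} → Iso (raw T) B → Tangle
Tangle-iso T {B} I = record
  { raw       = B
  ; nonempty  = ℕ.≤-trans (nonempty T) (Fin.injective⇒≤ (Injection.injective (↔⇒↣ intervals)))
  ; surj      = λ y → let i , b , p = surj T (vertices ⟨$⟩ˡ y) in
                  intervals ⟨$⟩ʳ i , b xor flip i ,
                  trans (compat i b) (trans (cong (vertices ⟨$⟩ʳ_) p) (Perm.inverseʳ vertices))
  ; connected = λ x y → subst₂ (Star (Adj B)) (Perm.inverseʳ vertices) (Perm.inverseʳ vertices)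
                  (gmap _ (Adj-iso I) (connected T _ _))
  }
  where open Iso I

EndsOnto : RawTangle → Set
EndsOnto A = ∀ x → ∃₂ λ i b → end A i b ≡ x

Connected : RawTangle → Set
Connected A = ∀ x y → Star (Adj A) x y

Link-sym : ∀ {A i j} → Link A i j → Link A j i
Link-sym {A} (b , b′ , shared , deg2) = b′ , b , sym shared , trans (cong (degree A) (sym shared)) deg2

module _ (A : RawTangle) (k : Fin (nI A)) where
  private
    S = subdivide A k

  end-subdivide-false : ∀ i → end S (suc i) false ≡ suc (end A i false)
  end-subdivide-false i with i ≟ k
  ... | yes _ = refl
  ... | no  _ = refl

  end-subdivide-≢ : ∀ {i} b → i ≢ k → end S (suc i) b ≡ suc (end A i b)
  end-subdivide-≢ {i} b i≢k with i ≟ k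
  ... | yes i≡k = contradiction i≡k i≢k
  ... | no  _   = refl

  end-subdivide-new : end S (suc k) true ≡ zero
  end-subdivide-new with k ≟ k
  ... | yes _   = refl
  ... | no  k≢k = contradiction refl k≢k

  degree-subdivide-new : degree S zero ≡ 2
  degree-subdivide-new = begin
    degree S zero                      ≡⟨ degree≡sum-incidence S zero ⟩
    1 + sum (incidence S zero ∘ suc)   ≡⟨ cong (1 +_) (sum-bump _ (λ _ → 0) k 1 at-k elsewhere) ⟩
    2 + sum {nI A} (λ _ → 0)           ≡⟨ cong (2 +_) (sum-const (nI A) 0) ⟩
    2 + nI A * 0                       ≡⟨ cong (2 +_) (ℕ.*-zeroʳ (nI A)) ⟩
    2                                  ∎
    where
    open ≡-Reasoning
    at-k : incidence S zero (suc k) ≡ 1 + 0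
    at-k rewrite end-subdivide-false k | end-subdivide-new = refl
    elsewhere : ∀ i → i ≢ k → incidence S zero (suc i) ≡ 0
    elsewhere i i≢k rewrite end-subdivide-false i | end-subdivide-≢ true i≢k = refl

  degree-subdivide-old : ∀ u → degree S (suc u) ≡ degree A u
  degree-subdivide-old u = begin
    degree S (suc u)                                                 ≡⟨ degree≡sum-incidence S (suc u) ⟩
    incidence S (suc u) zero + sum (incidence S (suc u) ∘ suc)       ≡⟨ sum-bump _ _ k _ at-k elsewhere ⟨
    sum (incidence A u)                                              ≡⟨ degree≡sum-incidence A u ⟨
    degree A u                                                       ∎
    where
    open ≡-Reasoning
    at-k : incidence A u k ≡ incidence S (suc u) zero + incidence S (suc u) (suc k)
    at-k rewrite end-subdivide-false k | end-subdivide-new | δ-suc (end A k true) u | δ-suc (end A k false) u =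
      trans (ℕ.+-comm (δ (end A k false) u) _) (cong (δ (end A k true) u +_) (sym (ℕ.+-identityʳ _)))
    elsewhere : ∀ i → i ≢ k → incidence A u i ≡ incidence S (suc u) (suc i)
    elsewhere i i≢k rewrite end-subdivide-false i | end-subdivide-≢ true i≢k =
      sym (cong₂ _+_ (δ-suc (end A i false) u) (δ-suc (end A i true) u))

  σ₃-subdivide : σ₃ S ≡ σ₃ A
  σ₃-subdivide = begin
    σ₃ S                                         ≡⟨ σ₃≡sum S ⟩
    χ₃ (degree S zero) + sum (χ₃ ∘ degree S ∘ suc)
      ≡⟨ cong₂ _+_ (cong χ₃ degree-subdivide-new) (sum-cong-≗ (cong χ₃ ∘ degree-subdivide-old)) ⟩
    sum (χ₃ ∘ degree A)                    ≡⟨ σ₃≡sum A ⟨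
    σ₃ A                                         ∎
    where open ≡-Reasoning

  parent : Fin (suc (nI A)) → Fin (nI A)
  parent zero    = k
  parent (suc i) = i

  end-old⇒end-parent : ∀ a β {u} → end S a β ≡ suc u → ∃ λ b → end A (parent a) b ≡ u
  end-old⇒end-parent zero    false ()
  end-old⇒end-parent zero    true  eq = true , Fin.suc-injective eq
  end-old⇒end-parent (suc i) false eq = false , Fin.suc-injective (trans (sym (end-subdivide-false i)) eq)
  end-old⇒end-parent (suc i) true  eq with i ≟ k
  end-old⇒end-parent (suc i) true () | yes _
  ... | no _ = true , Fin.suc-injective eq

  end-new⇒parent≡k : ∀ a β → end S a β ≡ zero → parent a ≡ k
  end-new⇒parent≡k zero    _     _  = refl
  end-new⇒parent≡k (suc i) false eq with () ← trans (sym (end-subdivide-false i)) eq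
  end-new⇒parent≡k (suc i) true  eq with i ≟ k
  ... | yes i≡k = i≡k
  end-new⇒parent≡k (suc i) true () | no _

  new-link : Link S (suc k) zero
  new-link = true , false , end-subdivide-new , trans (cong (degree S) end-subdivide-new) degree-subdivide-new

  Link-unsubdivide : ∀ {a c} → Link S a c → Star (Link A) (parent a) (parent c)
  Link-unsubdivide {a} {c} (β , β′ , shared , deg2) = via (end S a β) refl
    where
    via : ∀ x → end S a β ≡ x → Star (Link A) (parent a) (parent c)
    via zero    at-new = subst (Star (Link A) (parent a))
      (trans (end-new⇒parent≡k a β at-new) (sym (end-new⇒parent≡k c β′ (trans (sym shared) at-new)))) ε
    via (suc u) at-old =
      let b  , p  = end-old⇒end-parent a β at-old
          b′ , p′ = end-old⇒end-parent c β′ (trans (sym shared) at-old)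
      in (b , b′ , trans p (sym p′) ,
          trans (cong (degree A) p)
                (trans (sym (degree-subdivide-old u)) (trans (cong (degree S) (sym at-old)) deg2))) ◅ ε

  representative : ∀ i b → ∃₂ λ a β → end S a β ≡ suc (end A i b) × Star (Link S) (suc i) a
  representative i false = suc i , false , end-subdivide-false i , ε
  representative i true with i ≟ k
  ... | yes refl = zero , true , refl , new-link ◅ ε
  ... | no  i≢k  = suc i , true , end-subdivide-≢ true i≢k , ε

  Link-subdivide : ∀ {i j} → Link A i j → Star (Link S) (suc i) (suc j)
  Link-subdivide {i} {j} (b , b′ , shared , deg2) =
    let a , β  , ea , i⇝a = representative i b
        c , β′ , ec , j⇝c = representative j b′
    in i⇝a ◅◅ (β , β′ , trans ea (trans (cong suc shared) (sym ec)) ,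
               trans (cong (degree S) ea) (trans (degree-subdivide-old _) deg2))
            ◅ reverse (λ {a} {c} → Link-sym {S} {a} {c}) j⇝c

  EdgeCount-unsubdivide : ∀ {e} → EdgeCount S e → EdgeCount A e
  EdgeCount-unsubdivide (c , onto , same⇒linked , linked⇒same) =
    c ∘ suc , onto′ ,
    (λ i j eq → kleisliStar parent (λ {a} {c} → Link-unsubdivide {a} {c}) (same⇒linked (suc i) (suc j) eq)) ,
    (λ i j path → linked⇒same (suc i) (suc j) (kleisliStar suc (λ {i} {j} → Link-subdivide {i} {j}) path))
    where
    onto′ : ∀ l → ∃ λ i → c (suc i) ≡ l
    onto′ l with onto l
    ... | zero  , c₀≡l = k , trans (linked⇒same (suc k) zero (new-link ◅ ε)) c₀≡l
    ... | suc i , cᵢ≡l = i , cᵢ≡l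

  ends-onto-unsubdivide : EndsOnto S → EndsOnto A
  ends-onto-unsubdivide onto u =
    let a , β , p = onto (suc u)
        b , q     = end-old⇒end-parent a β p
    in parent a , b , q

  collapse : Fin (suc (nV A)) → Fin (nV A)
  collapse zero    = end A k true
  collapse (suc u) = u

  end-collapse : ∀ i b → end A i b ≡ collapse (end S (suc i) b)
  end-collapse i false rewrite end-subdivide-false i = refl
  end-collapse i true with i ≟ k
  ... | yes refl = refl
  ... | no  _    = refl

  Adj-unsubdivide : ∀ {x y} → Adj S x y → Star (Adj A) (collapse x) (collapse y)
  Adj-unsubdivide (zero  , inj₁ (refl , refl)) = ε
  Adj-unsubdivide (zero  , inj₂ (refl , refl)) = ε
  Adj-unsubdivide (suc i , inj₁ (refl , refl)) = (i , inj₁ (end-collapse i false , end-collapse i true)) ◅ ε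
  Adj-unsubdivide (suc i , inj₂ (refl , refl)) = (i , inj₂ (end-collapse i true , end-collapse i false)) ◅ ε

  connected-unsubdivide : Connected S → Connected A
  connected-unsubdivide conn x y = kleisliStar collapse Adj-unsubdivide (conn (suc x) (suc y))

Tangle-unsubdivide : (T : Tangle) {A : RawTangle} {k : Fin (nI A)} → Iso (subdivide A k) (raw T) → Tangle
Tangle-unsubdivide T {A} {k} I = record
  { raw       = A
  ; nonempty  = >-nonZero⁻¹ _ {{Fin.nonZeroIndex k}}
  ; surj      = ends-onto-unsubdivide A k (surj T′)
  ; connected = connected-unsubdivide A k (connected T′)
  }
  where T′ = Tangle-iso T (Iso-sym I)

HomeomorphicToBasic : RawTangle → Set
HomeomorphicToBasic A = ∃ λ B → B ∈ basicStringable × Homeomorphic A B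

HomeomorphicToBasic-iso : ∀ {A B} → Iso A B → HomeomorphicToBasic B → HomeomorphicToBasic A
HomeomorphicToBasic-iso I (C , C∈ , B≈C) = C , C∈ , fwd (inj₁ I) ◅ B≈C

HomeomorphicToBasic-subdivide : ∀ {A B k} → Iso (subdivide A k) B →
                                HomeomorphicToBasic A → HomeomorphicToBasic B
HomeomorphicToBasic-subdivide {k = k} I (C , C∈ , A≈C) = C , C∈ , bwd (inj₂ (k , I)) ◅ A≈C

-- Smoothing a vertex of degree 2

fromEnds : ∀ {n m} → (Fin n → Bool → Fin m) → RawTangle
fromEnds {n} {m} E = record { nI = n ; nV = m ; end = E }

relabel : (A : RawTangle) {n m : ℕ} → Permutation (nI A) n → Permutation (nV A) m → (Fin (nI A) → Bool) →
          RawTangle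
relabel A πI πV f = fromEnds λ j b → πV ⟨$⟩ʳ end A (πI ⟨$⟩ˡ j) (b xor f (πI ⟨$⟩ˡ j))

relabel-iso : ∀ A {n m} (πI : Permutation (nI A) n) (πV : Permutation (nV A) m) f → Iso A (relabel A πI πV f)
relabel-iso A πI πV f = record { intervals = πI ; vertices = πV ; flip = f ; compat = compat }
  where
  compat : ∀ i b → end (relabel A πI πV f) (πI ⟨$⟩ʳ i) (b xor f i) ≡ πV ⟨$⟩ʳ end A i b
  compat i b rewrite Perm.inverseˡ πI {i} | xor-cancelʳ b (f i) = refl

toFront : ∀ {n} (i : Fin n) → Permutation n (suc (pred n))
toFront zero    = Perm.id
toFront (suc i) = Perm.transpose zero (suc i)

toFront-from : ∀ {n} (i : Fin n) → toFront i ⟨$⟩ˡ zero ≡ i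
toFront-from zero    = refl
toFront-from (suc i) = refl

toFront-to : ∀ {n} (i : Fin n) → toFront i ⟨$⟩ʳ i ≡ zero
toFront-to i = trans (cong (toFront i ⟨$⟩ʳ_) (sym (toFront-from i))) (Perm.inverseʳ (toFront i))

contract : ∀ {n} → (∀ (x : Fin (suc n)) → x ≡ zero) → Permutation (suc n) 1
contract all-zero = Perm.permutation (λ _ → zero) (λ _ → zero) (λ { zero → refl ; (suc ()) }) (sym ∘ all-zero)

module _ {n m} (E : Fin (suc n) → Bool → Fin (suc m)) (conn : Connected (fromEnds E))
         (leaves : E zero false ≡ zero) (returns : E zero true ≡ zero) (deg2 : degree (fromEnds E) zero ≡ 2) where
  private
    R = fromEnds E
    g = incidence R zero ∘ suc

  others-absent : sum g ≡ 0
  others-absent = ℕ.+-cancelˡ-≡ 2 _ 0 (begin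
    2 + sum g                       ≡⟨ cong (_+ sum g) loop-incidence ⟨
    incidence R zero zero + sum g   ≡⟨ degree≡sum-incidence R zero ⟨
    degree R zero                   ≡⟨ deg2 ⟩
    2                               ∎)
    where
    open ≡-Reasoning
    loop-incidence : incidence R zero zero ≡ 2
    loop-incidence rewrite leaves | returns = refl

  others≢loop : ∀ j b → E (suc j) b ≢ zero
  others≢loop j b at-zero = contradiction (begin
    1                          ≤⟨ subst (λ x → 1 ≤ incidence R x (suc j)) at-zero (1≤incidence-end R (suc j) b) ⟩
    incidence R zero (suc j)   ≤⟨ term≤sum g j ⟩
    sum g                      ≡⟨ others-absent ⟩
    0                          ∎) λ ()
    where open ℕ.≤-Reasoning

  vertex-is-loop : ∀ (x : Fin (suc m)) → x ≡ zero
  vertex-is-loop x = walk (conn zero x) refl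
    where
    walk : ∀ {y z} → Star (Adj R) y z → y ≡ zero → z ≡ zero
    walk ε                                    y≡0 = y≡0
    walk ((zero  , inj₁ (refl , refl)) ◅ path) _  = walk path returns
    walk ((zero  , inj₂ (refl , refl)) ◅ path) _  = walk path leaves
    walk ((suc j , inj₁ (refl , refl)) ◅ path) y≡0 = contradiction y≡0 (others≢loop j false)
    walk ((suc j , inj₂ (refl , refl)) ◅ path) y≡0 = contradiction y≡0 (others≢loop j true)

  interval-is-loop : ∀ (i : Fin (suc n)) → i ≡ zero
  interval-is-loop zero    = refl
  interval-is-loop (suc j) = contradiction (vertex-is-loop (E (suc j) false)) (others≢loop j false)

  loop-is-circle : Iso R circle
  loop-is-circle = record
    { intervals = contract interval-is-loop
    ; vertices  = contract vertex-is-loop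
    ; flip      = λ _ → false
    ; compat    = λ _ _ → refl
    }

one-more-end : ∀ {n m} (E : Fin (suc n) → Bool → Fin (suc m)) → E zero false ≡ zero → E zero true ≢ zero →
               degree (fromEnds E) zero ≡ 2 → sum (incidence (fromEnds E) zero ∘ suc) ≡ 1
one-more-end E leaves escapes deg2 = ℕ.+-cancelˡ-≡ 1 _ 1 (begin
  1 + sum g                       ≡⟨ cong (_+ sum g) leaves-incidence ⟨
  incidence R zero zero + sum g   ≡⟨ degree≡sum-incidence R zero ⟨
  degree R zero                   ≡⟨ deg2 ⟩
  2                               ∎)
  where
  open ≡-Reasoning
  R = fromEnds E
  g = incidence R zero ∘ suc
  leaves-incidence : incidence R zero zero ≡ 1
  leaves-incidence = cong₂ _+_ (δ-≡ leaves) (δ-≢ escapes)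

module _ {n m} (E : Fin (suc n) → Bool → Fin (suc (suc m))) (k : Fin n)
         (leaves : E zero false ≡ zero) (escapes : E zero true ≢ zero) (k-arrives : E (suc k) true ≡ zero)
         (deg2 : degree (fromEnds E) zero ≡ 2) where
  private
    R = fromEnds E
    g = incidence R zero ∘ suc

    ends-at-zero : ∀ i b → E (suc i) b ≡ zero → 1 ≤ g i
    ends-at-zero i b at-zero = subst (λ x → 1 ≤ incidence R x (suc i)) at-zero (1≤incidence-end R (suc i) b)

  k-start≢zero : E (suc k) false ≢ zero
  k-start≢zero at-zero = contradiction (begin
    2        ≡⟨ cong₂ _+_ (δ-≡ at-zero) (δ-≡ k-arrives) ⟨
    g k      ≤⟨ term≤sum g k ⟩
    sum g    ≡⟨ one-more-end E leaves escapes deg2 ⟩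
    1        ∎) λ { (s≤s ()) }
    where open ℕ.≤-Reasoning

  others≢zero : ∀ {i} b → i ≢ k → E (suc i) b ≢ zero
  others≢zero {i} b i≢k at-zero = contradiction (begin
    1 + 1    ≤⟨ ℕ.+-mono-≤ (ends-at-zero i b at-zero) (ends-at-zero k true k-arrives) ⟩
    g i + g k ≤⟨ two-terms≤sum g i≢k ⟩
    sum g    ≡⟨ one-more-end E leaves escapes deg2 ⟩
    1        ∎) λ { (s≤s ()) }
    where open ℕ.≤-Reasoning

  -- Interval k+1 is prolonged through vertex 0 to the far end of interval 0; interval 0 and
  -- vertex 0 are dropped, and `pinch zero` renumbers the remaining vertices.
  smoothed : RawTangle
  smoothed = fromEnds λ i b → pinch zero (if isYes (i ≟ k) ∧ b then E zero true else E (suc i) b)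

  smoothed-iso : Iso (subdivide smoothed k) R
  smoothed-iso = record { intervals = Perm.id ; vertices = Perm.id ; flip = λ _ → false ; compat = compat }
    where
    suc-pinch : ∀ {x : Fin (suc (suc m))} → x ≢ zero → suc (pinch zero x) ≡ x
    suc-pinch {zero}  x≢0 = contradiction refl x≢0
    suc-pinch {suc x} _   = refl
    compat : ∀ a b → E a (b xor false) ≡ end (subdivide smoothed k) a b
    compat zero false = leaves
    compat zero true with k ≟ k
    ... | yes _   = sym (suc-pinch escapes)
    ... | no  k≢k = contradiction refl k≢k
    compat (suc i) false with i ≟ k
    ... | yes refl = sym (suc-pinch k-start≢zero)
    ... | no  i≢k  = sym (suc-pinch (others≢zero false i≢k))
    compat (suc i) true with i ≟ k
    ... | yes refl = k-arrives
    ... | no  i≢k  = sym (suc-pinch (others≢zero true i≢k))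

smooth-front : ∀ {n m} (E : Fin (suc n) → Bool → Fin (suc m)) → Connected (fromEnds E) →
               E zero false ≡ zero → degree (fromEnds E) zero ≡ 2 →
               Iso (fromEnds E) circle ⊎ ∃₂ λ A k → nV A < suc m × Iso (subdivide A k) (fromEnds E)
smooth-front {m = zero} E conn leaves deg2 = inj₁ (loop-is-circle E conn leaves (sole (E zero true)) deg2)
  where
  sole : (x : Fin 1) → x ≡ zero
  sole zero = refl
smooth-front {m = suc m} E conn leaves deg2 = by-return (E zero true ≟ zero)
  where
  -- Not a with-clause: abstracting `E zero true ≟ zero` would also rewrite it inside the
  -- normalised type of deg2.
  by-return : Dec (E zero true ≡ zero) →
              Iso (fromEnds E) circle ⊎ ∃₂ λ A k → nV A < suc (suc m) × Iso (subdivide A k) (fromEnds E)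
  by-return (yes returns) = inj₁ (loop-is-circle E conn leaves returns deg2)
  by-return (no escapes)  =
    inj₂ (smoothed E′ j leaves escapes arrives deg2′ , j , ℕ.≤-refl ,
          Iso-trans (smoothed-iso E′ j leaves escapes arrives deg2′) (Iso-sym orient))
    where
    R = fromEnds E
    other = sum-pos (incidence R zero ∘ suc) (ℕ.≤-reflexive (sym (one-more-end E leaves escapes deg2)))
    j = proj₁ other
    j-end = end-at R zero (suc j) (proj₂ other)
    β = proj₁ j-end
    flips = λ l → isYes (l ≟ suc j) ∧ not β
    orient = relabel-iso R Perm.id Perm.id flips
    E′ = end (relabel R Perm.id Perm.id flips)
    deg2′ : degree (fromEnds E′) zero ≡ 2
    deg2′ = trans (degree-iso orient zero) deg2
    arrives : E′ (suc j) true ≡ zero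
    arrives with suc j ≟ suc j
    ... | yes _   = trans (cong (E (suc j)) (Bool.not-involutive β)) (proj₂ j-end)
    ... | no  j≢j = contradiction refl j≢j

smooth : (T : Tangle) {v : Fin (nV (raw T))} → degree (raw T) v ≡ 2 →
         Iso (raw T) circle ⊎ ∃₂ λ A k → nV A < nV (raw T) × Iso (subdivide A k) (raw T)
smooth T {v} deg2 =
  Sum.map (Iso-trans front) (λ (A , k , smaller , sub) → A , k , shrink smaller , Iso-trans sub (Iso-sym front))
          (smooth-front (end R′) (connected (Tangle-iso T front)) leaves deg2′)
  where
  R = raw T
  i = proj₁ (surj T v)
  β = proj₁ (proj₂ (surj T v))
  i-at-v = proj₂ (proj₂ (surj T v))
  front = relabel-iso R (toFront i) (toFront v) (λ _ → β)
  R′ = relabel R (toFront i) (toFront v) (λ _ → β)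
  leaves : end R′ zero false ≡ zero
  leaves = begin
    toFront v ⟨$⟩ʳ end R (toFront i ⟨$⟩ˡ zero) β   ≡⟨ cong (λ l → toFront v ⟨$⟩ʳ end R l β) (toFront-from i) ⟩
    toFront v ⟨$⟩ʳ end R i β                      ≡⟨ cong (toFront v ⟨$⟩ʳ_) i-at-v ⟩
    toFront v ⟨$⟩ʳ v                              ≡⟨ toFront-to v ⟩
    zero                                          ∎
    where open ≡-Reasoning
  deg2′ : degree R′ zero ≡ 2
  deg2′ = subst (λ x → degree R′ x ≡ 2) (toFront-to v) (trans (degree-iso front v) deg2)
  shrink : ∀ {l} → l < suc (pred (nV R)) → l < nV R
  shrink = subst (_ <_) (ℕ.suc-pred (nV R) {{Fin.nonZeroIndex v}})

-- Tangles without vertices of degree 2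

1≤degree : (T : Tangle) → ∀ v → 1 ≤ degree (raw T) v
1≤degree T v = let i , b , at-v = surj T v in
  subst (λ x → 1 ≤ degree (raw T) x) at-v (1≤degree-end (raw T) i b)

intervals≤edges : ∀ {A e} → (∀ v → degree A v ≢ 2) → EdgeCount A e → nI A ≤ e
intervals≤edges {A} no-deg2 (c , _ , same⇒linked , _) =
  Fin.injective⇒≤ λ {i} {j} eq → unlinked (same⇒linked i j eq)
  where
  unlinked : ∀ {i j} → Star (Link A) i j → i ≡ j
  unlinked ε                          = refl
  unlinked ((_ , _ , _ , deg2) ◅ _) = contradiction deg2 (no-deg2 _)

vertices+2σ₃≤2intervals : ∀ {A} → (∀ v → 1 ≤ degree A v) → nV A + σ₃ A * 2 ≤ nI A * 2
vertices+2σ₃≤2intervals {A} 1≤deg = begin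
  nV A + σ₃ A * 2
    ≡⟨ cong₂ _+_ (ℕ.*-identityʳ (nV A)) (cong (_* 2) (sym (σ₃≡sum A))) ⟨
  nV A * 1 + sum (χ₃ ∘ degree A) * 2
    ≡⟨ cong₂ _+_ (sum-const (nV A) 1) (sym (*-distribʳ-sum 2 (χ₃ ∘ degree A))) ⟨
  sum {nV A} (λ _ → 1) + sum (λ v → χ₃ (degree A v) * 2)
    ≡⟨ ∑-distrib-+ (λ _ → 1) (λ v → χ₃ (degree A v) * 2) ⟨
  sum (λ v → 1 + χ₃ (degree A v) * 2)
    ≤⟨ sum-mono-≤ (λ v → bound (degree A v) (1≤deg v)) ⟩
  sum (degree A)
    ≡⟨ handshake A ⟩
  nI A * 2
    ∎
  where
  open ℕ.≤-Reasoning
  bound : ∀ d → 1 ≤ d → 1 + χ₃ d * 2 ≤ d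
  bound d 1≤d with 3 ≤? d
  ... | yes 3≤d = 3≤d
  ... | no  _   = 1≤d

σ₃≤vertices : ∀ A → σ₃ A ≤ nV A
σ₃≤vertices A = begin
  σ₃ A                          ≡⟨ σ₃≡sum A ⟩
  sum (χ₃ ∘ degree A)     ≤⟨ sum-mono-≤ (λ v → indicator≤1 (isYes (3 ≤? degree A v))) ⟩
  sum {nV A} (λ _ → 1)          ≡⟨ sum-const (nV A) 1 ⟩
  nV A * 1                      ≡⟨ ℕ.*-identityʳ (nV A) ⟩
  nV A                          ∎
  where
  open ℕ.≤-Reasoning
  indicator≤1 : ∀ b → ind b ≤ 1
  indicator≤1 false = z≤n
  indicator≤1 true  = s≤s z≤n

small-bounds : ∀ {v s i} → v + s * 2 ≤ i * 2 → s ≤ v → i < s + 2 → v ≤ 2 × i ≤ 3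
small-bounds {v} {s} {i} handshake s≤v i<s+2 = v≤2 , i≤3
  where
  i≤s+1 : i ≤ s + 1
  i≤s+1 = ℕ.m<1+n⇒m≤n (subst (i <_) (ℕ.+-suc s 1) i<s+2)
  v≤2 : v ≤ 2
  v≤2 = ℕ.+-cancelʳ-≤ (s * 2) v 2 (begin
    v + s * 2     ≤⟨ handshake ⟩
    i * 2         ≤⟨ ℕ.*-monoˡ-≤ 2 i≤s+1 ⟩
    (s + 1) * 2   ≡⟨ trans (ℕ.*-distribʳ-+ 2 s 1) (ℕ.+-comm (s * 2) 2) ⟩
    2 + s * 2     ∎)
    where open ℕ.≤-Reasoning
  i≤3 : i ≤ 3
  i≤3 = ℕ.≤-trans i≤s+1 (ℕ.+-monoˡ-≤ 1 (ℕ.≤-trans s≤v v≤2))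

-- Small tangles, by exhaustive search

Exhaustible : Set → Set₁
Exhaustible A = ∀ {P : A → Set} → Decidable P → Dec (∀ a → P a)

all-Bool? : Exhaustible Bool
all-Bool? P? = map′ (λ (pf , pt) → λ { false → pf ; true → pt }) (λ p → p false , p true)
                    (P? false ×-dec P? true)

any-Bool? : ∀ {P : Bool → Set} → Decidable P → Dec (∃ P)
any-Bool? P? = map′ (λ { (inj₁ p) → false , p ; (inj₂ p) → true , p })
                    (λ { (false , p) → inj₁ p ; (true , p) → inj₂ p })
                    (P? false ⊎-dec P? true)

all-×? : ∀ {A B} → Exhaustible A → Exhaustible B → Exhaustible (A × B)
all-×? all-A? all-B? P? = map′ (λ p (a , b) → p a b) (λ p a b → p (a , b))
                               (all-A? λ a → all-B? λ b → P? (a , b))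

all-Vec? : ∀ {A} → Exhaustible A → ∀ n → Exhaustible (Vec A n)
all-Vec? all-A? zero    P? = map′ (λ { p [] → p }) (λ p → p []) (P? [])
all-Vec? all-A? (suc n) P? = map′ (λ { p (x ∷ xs) → p x xs }) (λ p x xs → p (x ∷ xs))
                                  (all-A? λ x → all-Vec? all-A? n λ xs → P? (x ∷ xs))

permutations : ∀ m n → List (Permutation m n)
permutations zero    zero    = Perm.id ∷ []
permutations (suc m) (suc n) =
  concatMap (λ j → map (Perm.insert zero j) (permutations m n)) (allFin (suc n))
permutations _       _       = []

IsoVia : (A B : RawTangle) → Permutation (nI A) (nI B) × Permutation (nV A) (nV B) → Set
IsoVia A B (πI , πV) = ∀ i → ∃ λ c → ∀ b → end B (πI ⟨$⟩ʳ i) (b xor c) ≡ πV ⟨$⟩ʳ end A i b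

isoVia? : ∀ A B → Decidable (IsoVia A B)
isoVia? A B (πI , πV) =
  Fin.all? λ i → any-Bool? λ c → all-Bool? λ b → end B (πI ⟨$⟩ʳ i) (b xor c) Fin.≟ πV ⟨$⟩ʳ end A i b

isoVia⇒Iso : ∀ {A B} πs → IsoVia A B πs → Iso A B
isoVia⇒Iso (πI , πV) via =
  record { intervals = πI ; vertices = πV ; flip = proj₁ ∘ via ; compat = proj₂ ∘ via }

IsoToBasic : RawTangle → Set
IsoToBasic A =
  Any (λ B → Any (IsoVia A B) (cartesianProduct (permutations _ _) (permutations _ _))) basicStringable

IsoToBasic⇒HomeomorphicToBasic : ∀ {A} → IsoToBasic A → HomeomorphicToBasic A
IsoToBasic⇒HomeomorphicToBasic iso with find iso
... | B , B∈ , via = let πs , o = satisfied via in B , B∈ , fwd (inj₁ (isoVia⇒Iso πs o)) ◅ ε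

Table : ℕ → ℕ → Set
Table n m = Vec (Fin m × Fin m) n

fromTable : ∀ {n m} → Table n m → RawTangle
fromTable t = fromEnds λ i b → (if b then proj₂ else proj₁) (lookup t i)

table : (A : RawTangle) → Table (nI A) (nV A)
table A = Vec.tabulate λ i → end A i false , end A i true

table-iso : ∀ A → Iso A (fromTable (table A))
table-iso A = record { intervals = Perm.id ; vertices = Perm.id ; flip = λ _ → false ; compat = compat }
  where
  compat : ∀ i b → end (fromTable (table A)) i (b xor false) ≡ end A i b
  compat i false = cong proj₁ (lookup∘tabulate _ i)
  compat i true  = cong proj₂ (lookup∘tabulate _ i)

FewIntervals : RawTangle → Set
FewIntervals A = (∀ v → 1 ≤ degree A v) × 1 ≤ nI A × nI A < σ₃ A + 2

fewIntervals? : Decidable FewIntervals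
fewIntervals? A = Fin.all? (λ v → 1 ≤? degree A v) ×-dec 1 ≤? nI A ×-dec suc (nI A) ≤? σ₃ A + 2

SmallTablesBasic : ℕ → ℕ → Set
SmallTablesBasic n m = (t : Table n m) → FewIntervals (fromTable t) → IsoToBasic (fromTable t)

small-tables-basic : ∀ {n} → n < 4 → ∀ {m} → m < 3 → SmallTablesBasic n m
small-tables-basic = from-yes (ℕ.allUpTo? (λ n → ℕ.allUpTo? (tables? n) 3) 4)
  where
  tables? : ∀ n m → Dec (SmallTablesBasic n m)
  tables? n m = all-Vec? (all-×? Fin.all? Fin.all?) n λ t →
    fewIntervals? (fromTable t) →-dec any? (λ B → any? (isoVia? (fromTable t) B) _) basicStringable

reduced-few-edges⇒basic : (T : Tangle) → (∀ v → degree (raw T) v ≢ 2) →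
                           ∀ {e} → EdgeCount (raw T) e → e < σ₃ (raw T) + 2 → HomeomorphicToBasic (raw T)
reduced-few-edges⇒basic T no-deg2 {e} edges few =
  HomeomorphicToBasic-iso (table-iso A)
    (IsoToBasic⇒HomeomorphicToBasic (small-tables-basic (s≤s nI≤3) (s≤s nV≤2) (table A) candidate))
  where
  A = raw T
  nI<σ₃+2 : nI A < σ₃ A + 2
  nI<σ₃+2 = ℕ.≤-<-trans (intervals≤edges no-deg2 edges) few
  bounds = small-bounds (vertices+2σ₃≤2intervals {A} (1≤degree T)) (σ₃≤vertices A) nI<σ₃+2
  nV≤2 = proj₁ bounds
  nI≤3 = proj₂ bounds
  candidate : FewIntervals (fromTable (table A))
  candidate = (λ v → subst (1 ≤_) (sym (degree-iso (table-iso A) v)) (1≤degree T v)) ,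
              nonempty T ,
              subst (λ s → nI A < s + 2) (sym (σ₃-iso (table-iso A))) nI<σ₃+2

few-edges⇒basic : ∀ s (T : Tangle) → nV (raw T) < s →
                  ∀ {e} → EdgeCount (raw T) e → e < σ₃ (raw T) + 2 → HomeomorphicToBasic (raw T)
few-edges⇒basic (suc s) T nV<1+s {e} edges few with Fin.any? (λ v → degree (raw T) v ℕ.≟ 2)
... | no  no-deg2 = reduced-few-edges⇒basic T (λ v deg2 → no-deg2 (v , deg2)) edges few
... | yes (v , deg2) with smooth T deg2
...   | inj₁ circ = circle , there (here refl) , fwd (inj₁ circ) ◅ ε
...   | inj₂ (A , k , smaller , sub) =
  HomeomorphicToBasic-subdivide sub
    (few-edges⇒basic s (Tangle-unsubdivide T sub) (ℕ.<-≤-trans smaller (s≤s⁻¹ nV<1+s))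
      (EdgeCount-unsubdivide A k (EdgeCount-iso (Iso-sym sub) edges))
      (subst (λ σ → e < σ + 2) (trans (σ₃-iso sub) (σ₃-subdivide A k)) few))

lemma2p12 : (T : Tangle)
    → (∀ B → B ∈ basicStringable → ¬ Homeomorphic (raw T) B)
    → ∀ (e : ℕ) → EdgeCount (raw T) e
    → σ₃ (raw T) + 2 ≤ e
lemma2p12 T not-basic e edges with σ₃ (raw T) + 2 ≤? e
... | yes enough = enough
... | no  few    =
  let B , B∈ , T≈B = few-edges⇒basic _ T ℕ.≤-refl edges (ℕ.≰⇒> few)
  in  contradiction T≈B (not-basic B B∈)
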